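{- Let $E$ be a finite set, let $a,b\in E$ be distinct, and let $(\sigma_\circ,\sigma_\bullet)$ be an arbitrary pair in $S_E$ (not necessarily transitive). Let $(\sigma_\circ^{\oplus},\sigma_\bullet^{\oplus})$ be the reroute of $(\sigma_\circ,\sigma_\bullet)$ relative to $(a,b)$, let $g$ be the synthetic genus of $(\sigma_\circ,\sigma_\bullet)$ and $g^{\oplus}$ the synthetic genus of $(\sigma_\circ^{\oplus},\sigma_\bullet^{\oplus})$. Then: (1) if $(\sigma_\circ,\sigma_\bullet)$ is Type U relative to $(a,b)$ then $g^{\oplus}=g+1$; (2) if it is Type N relative to $(a,b)$ then $g^{\oplus}=g-1$; (3) if it is Type P relative to $(a,b)$ then $g^{\oplus}=g$.
   Context: Permutations compose functionally: $(\pi_1\pi_2)(e)=\pi_1(\pi_2(e))$. For $\pi\in S_E$, $z(\pi)$ denotes the number of $\pi$-orbits (fixed points count as orbits). The synthetic Euler characteristic of a pair $(\sigma_\circ,\sigma_\bullet)$ in $S_E$ is $\chi=z(\sigma_\circ)+z(\sigma_\bullet)-|E|+z(\sigma_\circ\sigma_\bullet)$ and its synthetic genus is $g=1-\chi/2$. Reroute: put $E^{\oplus}=(E\setminus\{a\})\sqcup\{a_\circ,a_\bullet\}$ with new symbols $a_\circ,a_\bullet$. $\sigma_\circ^{\oplus}\in S_{E^\oplus}$ is obtained from the disjoint cycle decomposition of $\sigma_\circ$ (fixed points written as 1-cycles) by replacing the symbol $a$ by $a_\circ$ and inserting the symbol $a_\bullet$ immediately before $b$ in the cycle containing $b$ (so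 $\sigma_\circ^\oplus(a_\bullet)=b$ and the element formerly sent to $b$ is now sent to $a_\bullet$). $\sigma_\bullet^{\oplus}\in S_{E^\oplus}$ is obtained from the disjoint cycle decomposition of $\sigma_\bullet$ by replacing $a$ by $a_\bullet$ and adjoining the fixed point $a_\circ$. Arcs: for $\pi\in S_E$ and $x,y$ in the same $\pi$-orbit, let $x_0,\dots,x_n$ be the shortest sequence with $x_0=x$, $x_n=y$, $x_{i+1}=\pi(x_i)$. If $x\neq y$ the $\pi$-arc from $x$ to $y$ is the sequence $x_1,\dots,x_n$; if $x=y$ it is empty. Types relative to $(a,b)$, with orbits meaning $\sigma_\circ\sigma_\bullet$-orbits: Type U iff $a,\sigma_\circ(a),b$ are pairwise distinct and lie in three distinct orbits; Type N iff $a,\sigma_\circ(a),b$ lie in a single orbit and the $\sigma_\circ\sigma_\bullet$-arc from $a$ to $b$ does not contain $\sigma_\circ(a)$; Type P iff neither Type U nor Type N. -}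

module Defs where

open import Data.Nat as ℕ using (ℕ; zero; suc; _<_; _≤_)
open import Data.Nat.Properties using ()
open import Data.Fin as Fin using (Fin; zero; suc; _≤?_)
open import Data.Fin.Permutation as P using (Permutation′; _⟨$⟩ʳ_; _∘ₚ_; lift₀; transpose)
open import Data.List using (List; upTo; length; filter; allFin)
open import Data.List.Relation.Unary.All using (All; all?)
open import Data.Integer as ℤ using (ℤ; +_)
open import Data.Rational as ℚ using (ℚ; 1ℚ)
open import Data.Product using (Σ; ∃; ∃-syntax; _×_)
open import Relation.Nullary using (¬_)
open import Relation.Binary.PropositionalEquality using (_≡_; _≢_)

-- Finite sets E are modelled as Fin n; S_E as Permutation′ n.
Perm : ℕ → Set
Perm n = Permutation′ n

-- Functional composition: (π₁ · π₂)(e) = π₁(π₂(e)).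
-- (The library's _∘ₚ_ is diagrammatic: (π₁ ∘ₚ π₂)(e) = π₂(π₁(e)).)
infixl 7 _·_
_·_ : ∀ {n} → Perm n → Perm n → Perm n
π₁ · π₂ = π₂ ∘ₚ π₁

iter : ∀ {n} → Perm n → ℕ → Fin n → Fin n
iter π zero    x = x
iter π (suc k) x = π ⟨$⟩ʳ (iter π k x)

SameOrbit : ∀ {n} → Perm n → Fin n → Fin n → Set
SameOrbit π x y = ∃[ k ] iter π k x ≡ y

-- z(π): number of π-orbits, counted as the number of elements x that are
-- the least element (w.r.t. the order of Fin n) of their orbit.  The orbit
-- of x is {π^k x | k < n} (an orbit in S_n has at most n elements).
z : ∀ {n} → Perm n → ℕ
z {n} π = length (filter (λ x → all? (λ k → x ≤? iter π k x) (upTo n)) (allFin n))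

χ : ∀ {n} → Perm n → Perm n → ℤ
χ {n} s∘ s• = ((+ z s∘) ℤ.+ (+ z s•)) ℤ.- (+ n) ℤ.+ (+ z (s∘ · s•))

genus : ∀ {n} → Perm n → Perm n → ℚ
genus s∘ s• = 1ℚ ℚ.- (χ s∘ s• ℚ./ 2)

-- E⊕ is modelled as Fin (suc n):
-- an old element e ∈ E∖{a} is  suc e,  a∘ is  suc a,  a• is  zero.
-- σ∘⊕ = (0 ↔ suc b) · lift σ∘ :  a• ↦ b,  e ↦ σ∘ e  unless σ∘ e = b, in
--   which case e ↦ a•  (a is renamed a∘ throughout).
reroute∘ : ∀ {n} → Fin n → Fin n → Perm n → Perm n → Perm (suc n)
reroute∘ a b s∘ s• = transpose zero (suc b) · lift₀ s∘

-- σ•⊕ = τ · lift σ• · τ  with τ = (0 ↔ suc a): the cycles of σ• with a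
--   renamed a• (= zero), plus the fixed point a∘ (= suc a).
reroute• : ∀ {n} → Fin n → Fin n → Perm n → Perm n → Perm (suc n)
reroute• a b s∘ s• = τ · lift₀ s• · τ
  where τ = transpose zero (suc a)

ArcContains : ∀ {n} → Perm n → Fin n → Fin n → Fin n → Set
ArcContains π x y c =
  ∃[ d ] (iter π d x ≡ y × (∀ k → k < d → iter π k x ≢ y)
         × ∃[ i ] (1 ≤ i × i ≤ d × iter π i x ≡ c))

TypeU : ∀ {n} → Perm n → Perm n → Fin n → Fin n → Set
TypeU s∘ s• a b =
  (a ≢ s∘ ⟨$⟩ʳ a × a ≢ b × s∘ ⟨$⟩ʳ a ≢ b) ×
  (¬ SameOrbit ρ a (s∘ ⟨$⟩ʳ a) × ¬ SameOrbit ρ a b × ¬ SameOrbit ρ (s∘ ⟨$⟩ʳ a) b)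
  where ρ = s∘ · s•

TypeN : ∀ {n} → Perm n → Perm n → Fin n → Fin n → Set
TypeN s∘ s• a b =
  (SameOrbit ρ a (s∘ ⟨$⟩ʳ a) × SameOrbit ρ a b) ×
  ¬ ArcContains ρ a b (s∘ ⟨$⟩ʳ a)
  where ρ = s∘ · s•

TypeP : ∀ {n} → Perm n → Perm n → Fin n → Fin n → Set
TypeP s∘ s• a b = ¬ TypeU s∘ s• a b × ¬ TypeN s∘ s• a b

-- Write ρ = σ∘σ•, π↑ for a permutation π lifted to E⊕ with a• fixed, and (x y) for transpositions.
-- Both reroutes are lifts corrected by transpositions: σ∘⊕ = (a• b)·σ∘↑ and, after conjugating, σ•⊕ =
-- (a• a∘)·(a• σ•a)·σ•↑, while σ∘⊕σ•⊕ = (a• b)·(a• σ∘a)·(a• ρa)·ρ↑.  Composing with (u v) merges the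
-- orbits of u and v when they differ (one orbit fewer) and otherwise splits their common orbit (one
-- orbit more).  So z(σ∘⊕) = z(σ∘) and z(σ•⊕) = z(σ•) + 1, and (a• ρa) splices a• into the ρ-cycle of a
-- just after a.  If σ∘a lies on another cycle, (a• σ∘a) merges the two, and (a• b) splits the result
-- again unless b lies on neither cycle (Type U).  If σ∘a lies on the same cycle, (a• σ∘a) cuts off the
-- cycle a•, ρa, …, ρᵗa ending just before σ∘a, and (a• b) splits it once more exactly when b is on it,
-- that is, when the arc from a to b avoids σ∘a (Type N).  Thus z(σ∘⊕σ•⊕) − z(ρ) is −2, 2, 0 in Types
-- U, N, P; as |E⊕| = |E| + 1, χ changes by the same amount and g by minus its half.

module Submission where

open import Defs
open import Data.Nat as ℕ using (ℕ; zero; suc; z≤n; s≤s; _+_; _*_)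
import Data.Nat.Properties as ℕₚ
open import Data.Fin as Fin using (Fin; zero; suc; toℕ)
import Data.Fin.Properties as Finₚ
open import Data.Fin.Permutation using (_⟨$⟩ʳ_; _⟨$⟩ˡ_; inverseˡ; transpose; lift₀)
import Data.Fin.Permutation.Components as PC
open import Data.List using (upTo; filter; tabulate; length)
open import Data.List.Relation.Unary.All as All using (All; all?)
open import Data.List.Membership.Propositional.Properties using (∈-upTo⁺)
open import Data.Integer as ℤ using (+_; -[1+_])
open import Data.Integer.Solver using (module +-*-Solver)
open import Data.Rational as ℚ using (1ℚ; toℚᵘ)
import Data.Rational.Properties as ℚₚ
import Data.Rational.Unnormalised as ℚᵘ
import Data.Rational.Unnormalised.Properties as ℚᵘₚ
import Data.Rational.Solver as ℚSolver
open import Data.Bool using (true; false)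
open import Data.Product using (∃; _×_; _,_; proj₁; proj₂)
open import Data.Sum using (_⊎_; inj₁; inj₂; [_,_])
open import Data.Empty using (⊥-elim)
open import Function using (_∘_; _⇔_; mk⇔; Equivalence)
open import Relation.Binary using (tri<; tri≈; tri>)
open import Relation.Nullary using (¬_; Dec; yes; no; does)
import Relation.Nullary.Decidable as Dec
open import Relation.Unary using (Decidable; _⊆_; _≐_)
open import Relation.Binary.PropositionalEquality hiding ([_])

private variable
  n : ℕ

least : {P : ℕ → Set} → Decidable P → ∀ {m} → P m →
        ∃ λ d → P d × (∀ j → j ℕ.< d → ¬ P j)
least P? {zero} p = zero , p , λ _ ()
least P? {suc m} p with P? zero
... | yes p₀ = zero , p₀ , λ _ ()
... | no ¬p₀ with least (P? ∘ suc) p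
...   | d , pd , below = suc d , pd , λ { zero _ → ¬p₀ ; (suc j) (s≤s j<d) → below j j<d }

leastFin : ∀ {m} {P : Fin m → Set} → Decidable P → ∀ {w} → P w →
           ∃ λ c → P c × (∀ y → P y → c Fin.≤ y)
leastFin {suc m} P? {w} pw with P? zero
... | yes p₀ = zero , p₀ , λ _ _ → z≤n
leastFin {suc m} P? {zero}  p₀ | no ¬p₀ = ⊥-elim (¬p₀ p₀)
leastFin {suc m} P? {suc w} pw | no ¬p₀ with leastFin (P? ∘ suc) pw
... | c , pc , below = suc c , pc , λ { zero p₀ → ⊥-elim (¬p₀ p₀) ; (suc y) py → s≤s (below y py) }

-- Orbits

infix 4 _~[_]_
_~[_]_ : Fin n → Perm n → Fin n → Set
x ~[ π ] y = SameOrbit π x y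

⟨$⟩ʳ-injective : (π : Perm n) {x y : Fin n} → π ⟨$⟩ʳ x ≡ π ⟨$⟩ʳ y → x ≡ y
⟨$⟩ʳ-injective π {x} {y} eq = begin
  x                  ≡⟨ inverseˡ π ⟨
  π ⟨$⟩ˡ (π ⟨$⟩ʳ x)  ≡⟨ cong (π ⟨$⟩ˡ_) eq ⟩
  π ⟨$⟩ˡ (π ⟨$⟩ʳ y)  ≡⟨ inverseˡ π ⟩
  y                  ∎
  where open ≡-Reasoning

iter-+ : (π : Perm n) (m k : ℕ) (x : Fin n) → iter π (m + k) x ≡ iter π m (iter π k x)
iter-+ π zero    k x = refl
iter-+ π (suc m) k x = cong (π ⟨$⟩ʳ_) (iter-+ π m k x)

iter-cancelˡ : (π : Perm n) (i k : ℕ) (x : Fin n) → iter π i x ≡ iter π (i + k) x → x ≡ iter π k x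
iter-cancelˡ π zero    k x eq = eq
iter-cancelˡ π (suc i) k x eq = iter-cancelˡ π i k x (⟨$⟩ʳ-injective π eq)

-- Pigeonhole among x, π x, …, πⁿ x.
period : (π : Perm n) (x : Fin n) → ∃ λ q → suc q ℕ.≤ n × iter π (suc q) x ≡ x
period {n} π x with Finₚ.pigeonhole (ℕₚ.n<1+n n) (λ i → iter π (toℕ i) x)
... | i , j , i<j , eq with ℕₚ.m≤n⇒∃[o]m+o≡n i<j
...   | q , i+1+q≡j = q , sq≤n , sym (iter-cancelˡ π (toℕ i) (suc q) x (trans eq (cong (λ k → iter π k x) j≡i+1+q)))
  where
  j≡i+1+q : toℕ j ≡ toℕ i + suc q
  j≡i+1+q = trans (sym i+1+q≡j) (sym (ℕₚ.+-suc (toℕ i) q))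
  sq≤n : suc q ℕ.≤ n
  sq≤n = ℕₚ.≤-trans (ℕₚ.m≤n+m (suc q) (toℕ i)) (subst (ℕ._≤ n) j≡i+1+q (ℕₚ.≤-pred (Finₚ.toℕ<n j)))

iter-periodic : (π : Perm n) {x : Fin n} {q : ℕ} → iter π (suc q) x ≡ x →
                ∀ k → ∃ λ j → j ℕ.≤ q × iter π k x ≡ iter π j x
iter-periodic π eq zero = zero , z≤n , refl
iter-periodic π {q = q} eq (suc k) with iter-periodic π eq k
... | j , j≤q , eqj with ℕₚ.m≤n⇒m<n∨m≡n j≤q
...   | inj₁ j<q  = suc j , j<q , cong (π ⟨$⟩ʳ_) eqj
...   | inj₂ refl = zero , z≤n , trans (cong (π ⟨$⟩ʳ_) eqj) eq

iter-multiple : (π : Perm n) {x : Fin n} {p : ℕ} → iter π p x ≡ x → ∀ k → iter π (k * p) x ≡ x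
iter-multiple π         eq zero    = refl
iter-multiple π {x} {p} eq (suc k) = begin
  iter π (p + k * p) x         ≡⟨ iter-+ π p (k * p) x ⟩
  iter π p (iter π (k * p) x)  ≡⟨ cong (iter π p) (iter-multiple π eq k) ⟩
  iter π p x                   ≡⟨ eq ⟩
  x                            ∎
  where open ≡-Reasoning

~-refl : (π : Perm n) {x : Fin n} → x ~[ π ] x
~-refl π = 0 , refl

~-step : (π : Perm n) (x : Fin n) → x ~[ π ] π ⟨$⟩ʳ x
~-step π x = 1 , refl

~-trans : (π : Perm n) {x y w : Fin n} → x ~[ π ] y → y ~[ π ] w → x ~[ π ] w
~-trans π {x} (k , refl) (l , refl) = l + k , iter-+ π l k x

~-sym : (π : Perm n) {x y : Fin n} → x ~[ π ] y → y ~[ π ] x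
~-sym π {x} (k , refl) with period π x
... | q , _ , eq = k * q , (begin
  iter π (k * q) (iter π k x)  ≡⟨ iter-+ π (k * q) k x ⟨
  iter π (k * q + k) x         ≡⟨ cong (λ m → iter π m x) (trans (ℕₚ.+-comm (k * q) k) (sym (ℕₚ.*-suc k q))) ⟩
  iter π (k * suc q) x         ≡⟨ iter-multiple π eq k ⟩
  x                            ∎)
  where open ≡-Reasoning

~-induction : (π : Perm n) (R : Fin n → Fin n → Set) →
              (∀ {x} → R x x) → (∀ {x y w} → R x y → R y w → R x w) → (∀ x → R x (π ⟨$⟩ʳ x)) →
              ∀ {x y} → x ~[ π ] y → R x y
~-induction π R R-refl R-trans R-step (zero  , refl) = R-refl
~-induction π R R-refl R-trans R-step (suc k , refl) =
  R-trans (~-induction π R R-refl R-trans R-step (k , refl)) (R-step _)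

~-bounded : (π : Perm n) {x y : Fin n} → x ~[ π ] y → ∃ λ j → j ℕ.< n × iter π j x ≡ y
~-bounded π {x} (k , refl) with period π x
... | q , sq≤n , eq with iter-periodic π eq k
...   | j , j≤q , eqj = j , ℕₚ.<-≤-trans (s≤s j≤q) sq≤n , sym eqj

~-dec : (π : Perm n) (x y : Fin n) → Dec (x ~[ π ] y)
~-dec {n} π x y = Dec.map′ (λ (k , eq) → toℕ k , eq) bounded (Finₚ.any? (λ k → iter π (toℕ k) x Finₚ.≟ y))
  where
  bounded : x ~[ π ] y → ∃ λ (k : Fin n) → iter π (toℕ k) x ≡ y
  bounded x~y with ~-bounded π x~y
  ... | j , j<n , eq = Fin.fromℕ< j<n , subst (λ i → iter π i x ≡ y) (sym (Finₚ.toℕ-fromℕ< j<n)) eq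

FirstHit : Perm n → Fin n → Fin n → ℕ → Set
FirstHit π x c t = iter π (suc t) x ≡ c × (∀ j → j ℕ.< t → iter π (suc j) x ≢ c)

firstHit : (π : Perm n) {x c : Fin n} → x ~[ π ] c → ∃ (FirstHit π x c)
firstHit π {x} (k , refl) with period π (iter π k x)
... | q , _ , eq = least (λ j → iter π (suc j) x Finₚ.≟ iter π k x) {q + k} (trans (iter-+ π (suc q) k x) eq)

firstHit-noReturn : (π : Perm n) {x c : Fin n} {t : ℕ} → FirstHit π x c t →
                    ∀ j → j ℕ.< t → iter π (suc j) x ≢ x
firstHit-noReturn π {t = t} (hit , below) j j<t ret with iter-periodic π ret (suc t)
... | zero   , _     , eq = below j j<t (trans ret (trans (sym eq) hit))
... | suc i  , si≤j , eq = below i (ℕₚ.<-trans si≤j j<t) (trans (sym eq) hit)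

Within : Perm n → Fin n → ℕ → Fin n → Set
Within π x t y = ∃ λ j → j ℕ.< t × iter π (suc j) x ≡ y

within⇒¬arc : (π : Perm n) {x c y : Fin n} {t : ℕ} → FirstHit π x c t →
              Within π x t y → ¬ ArcContains π x y c
within⇒¬arc π (_ , below) (j , j<t , eq) (d , _ , d-least , zero  , ()    , _)
within⇒¬arc π (_ , below) (j , j<t , eq) (d , _ , d-least , suc i , _ , si≤d , hit) =
  below i (ℕₚ.≤-trans si≤d (ℕₚ.≤-trans d≤sj j<t)) hit
  where
  d≤sj : d ℕ.≤ suc j
  d≤sj = ℕₚ.≮⇒≥ (λ sj<d → d-least (suc j) sj<d eq)

¬arc⇒within : (π : Perm n) {x c y : Fin n} {t : ℕ} → FirstHit π x c t →
              x ≢ y → x ~[ π ] y → ¬ ArcContains π x y c → Within π x t y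
¬arc⇒within π {x} {y = y} {t} (hit , _) x≢y (k , eq) ¬arc with least (λ j → iter π j x Finₚ.≟ y) {k} eq
... | zero   , eq₀ , _      = ⊥-elim (x≢y eq₀)
... | suc d  , eqd , d-least with t ℕ.≤? d
...   | yes t≤d = ⊥-elim (¬arc (suc d , eqd , d-least , suc t , s≤s z≤n , s≤s t≤d , hit))
...   | no  t≰d = d , ℕₚ.≰⇒> t≰d , eqd

-- Counting orbits

count : ∀ {m} {P : Fin m → Set} → Decidable P → ℕ
count {zero}  P? = 0
count {suc m} P? with does (P? zero)
... | true  = suc (count (P? ∘ suc))
... | false = count (P? ∘ suc)

count-accept : ∀ {m} {P : Fin (suc m) → Set} (P? : Decidable P) → P zero → count P? ≡ suc (count (P? ∘ suc))
count-accept P? p₀ with P? zero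
... | yes _  = refl
... | no ¬p₀ = ⊥-elim (¬p₀ p₀)

length-filter-tabulate : ∀ {m} {A : Set} {P : A → Set} (P? : Decidable P) (f : Fin m → A) →
                         length (filter P? (tabulate f)) ≡ count (P? ∘ f)
length-filter-tabulate {zero}  P? f = refl
length-filter-tabulate {suc m} P? f with does (P? (f zero))
... | true  = cong suc (length-filter-tabulate P? (f ∘ suc))
... | false = length-filter-tabulate P? (f ∘ suc)

count-≐ : ∀ {m} {P Q : Fin m → Set} (P? : Decidable P) (Q? : Decidable Q) → P ≐ Q → count P? ≡ count Q?
count-≐ {zero}  P? Q? P≐Q = refl
count-≐ {suc m} P? Q? (P⊆Q , Q⊆P) with P? zero | Q? zero
... | yes _  | yes _  = cong suc (count-≐ (P? ∘ suc) (Q? ∘ suc) (P⊆Q , Q⊆P))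
... | no _   | no _   = count-≐ (P? ∘ suc) (Q? ∘ suc) (P⊆Q , Q⊆P)
... | yes p  | no ¬q  = ⊥-elim (¬q (P⊆Q p))
... | no ¬p  | yes q  = ⊥-elim (¬p (Q⊆P q))

count-one-more : ∀ {m} {P Q : Fin m → Set} (P? : Decidable P) (Q? : Decidable Q) (c : Fin m) →
                 P c → ¬ Q c → (∀ x → x ≢ c → P x → Q x) → Q ⊆ P →
                 count P? ≡ suc (count Q?)
count-one-more {suc m} P? Q? zero pc ¬qc P⊆Q Q⊆P with P? zero | Q? zero
... | yes _  | no _  = cong suc (count-≐ (P? ∘ suc) (Q? ∘ suc) ((λ {x} → P⊆Q (suc x) λ ()) , Q⊆P))
... | no ¬p  | _     = ⊥-elim (¬p pc)
... | yes _  | yes q = ⊥-elim (¬qc q)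
count-one-more {suc m} P? Q? (suc c) pc ¬qc P⊆Q Q⊆P
  with P? zero | Q? zero
     | count-one-more (P? ∘ suc) (Q? ∘ suc) c pc ¬qc (λ x x≢c → P⊆Q (suc x) (x≢c ∘ Finₚ.suc-injective)) Q⊆P
... | yes _ | yes _  | rest = cong suc rest
... | no _  | no _   | rest = rest
... | yes p | no ¬q  | _    = ⊥-elim (¬q (P⊆Q zero (λ ()) p))
... | no ¬p | yes q  | _    = ⊥-elim (¬p (Q⊆P q))

IsOrbitMin : Perm n → Fin n → Set
IsOrbitMin π x = ∀ y → x ~[ π ] y → x Fin.≤ y

iterBounds⇔orbitMin : (π : Perm n) (x : Fin n) → All (λ k → x Fin.≤ iter π k x) (upTo n) ⇔ IsOrbitMin π x
iterBounds⇔orbitMin {n} π x = mk⇔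
  (λ bounds y x~y → let j , j<n , eq = ~-bounded π x~y in subst (x Fin.≤_) eq (All.lookup bounds (∈-upTo⁺ j<n)))
  (λ min → All.tabulate λ {k} _ → min (iter π k x) (k , refl))

isOrbitMin? : (π : Perm n) → Decidable (IsOrbitMin π)
isOrbitMin? {n} π x = Dec.map (iterBounds⇔orbitMin π x) (all? (λ k → x Fin.≤? iter π k x) (upTo n))

z≡count-orbitMin : (π : Perm n) → z π ≡ count (isOrbitMin? π)
z≡count-orbitMin {n} π = trans (length-filter-tabulate {n} (λ x → all? (λ k → x Fin.≤? iter π k x) (upTo n)) (λ x → x))
  (count-≐ _ (isOrbitMin? π) ((λ {x} → Equivalence.to (iterBounds⇔orbitMin π x)) , λ {x} → Equivalence.from (iterBounds⇔orbitMin π x)))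

data TransposeCase {n} (u v w : Fin n) : Fin n → Set where
  at-u      : w ≡ u → TransposeCase u v w v
  at-v      : w ≡ v → TransposeCase u v w u
  elsewhere : w ≢ u → w ≢ v → TransposeCase u v w w

transpose-case : (u v w : Fin n) → TransposeCase u v w (PC.transpose u v w)
transpose-case u v w with w Finₚ.≟ u
... | yes w≡u = at-u w≡u
... | no  w≢u with w Finₚ.≟ v
...   | yes w≡v = at-v w≡v
...   | no  w≢v = elsewhere w≢u w≢v

transpose-≡ˡ : (u v : Fin n) → transpose u v ⟨$⟩ʳ u ≡ v
transpose-≡ˡ u v with PC.transpose u v u | transpose-case u v u
... | _ | at-u _          = refl
... | _ | at-v u≡v        = u≡v
... | _ | elsewhere u≢u _ = ⊥-elim (u≢u refl)

transpose-≡ʳ : (u v : Fin n) → transpose u v ⟨$⟩ʳ v ≡ u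
transpose-≡ʳ u v with PC.transpose u v v | transpose-case u v v
... | _ | at-u v≡u        = v≡u
... | _ | at-v _          = refl
... | _ | elsewhere _ v≢v = ⊥-elim (v≢v refl)

transpose-≢ : (u v : Fin n) {w : Fin n} → w ≢ u → w ≢ v → transpose u v ⟨$⟩ʳ w ≡ w
transpose-≢ u v {w} w≢u w≢v with PC.transpose u v w | transpose-case u v w
... | _ | at-u w≡u       = ⊥-elim (w≢u w≡u)
... | _ | at-v w≡v       = ⊥-elim (w≢v w≡v)
... | _ | elsewhere _ _  = refl

transpose-involutive : (u v w : Fin n) → transpose u v ⟨$⟩ʳ (transpose u v ⟨$⟩ʳ w) ≡ w
transpose-involutive u v w with PC.transpose u v w | transpose-case u v w
... | _ | at-u refl           = transpose-≡ʳ u v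
... | _ | at-v refl           = transpose-≡ˡ u v
... | _ | elsewhere w≢u w≢v   = transpose-≢ u v w≢u w≢v

transpose-conjugate : (f : Perm n) (u v w : Fin n) →
                      f ⟨$⟩ʳ (transpose u v ⟨$⟩ʳ w) ≡ transpose (f ⟨$⟩ʳ u) (f ⟨$⟩ʳ v) ⟨$⟩ʳ (f ⟨$⟩ʳ w)
transpose-conjugate f u v w with PC.transpose u v w | transpose-case u v w
... | _ | at-u refl         = sym (transpose-≡ˡ (f ⟨$⟩ʳ u) (f ⟨$⟩ʳ v))
... | _ | at-v refl         = sym (transpose-≡ʳ (f ⟨$⟩ʳ u) (f ⟨$⟩ʳ v))
... | _ | elsewhere w≢u w≢v = sym (transpose-≢ (f ⟨$⟩ʳ u) (f ⟨$⟩ʳ v) (w≢u ∘ ⟨$⟩ʳ-injective f) (w≢v ∘ ⟨$⟩ʳ-injective f))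

-- Composing with a transposition

OrbitMinOf : Perm n → Fin n → Fin n → Set
OrbitMinOf π u m = u ~[ π ] m × IsOrbitMin π m

orbitMin : (π : Perm n) (u : Fin n) → ∃ (OrbitMinOf π u)
orbitMin π u with leastFin (~-dec π u) (~-refl π)
... | m , u~m , m≤ = m , u~m , λ y m~y → m≤ y (~-trans π u~m m~y)

MergedOrbits : Perm n → Fin n → Fin n → Fin n → Fin n → Set
MergedOrbits π u v x y = x ~[ π ] y ⊎ (x ~[ π ] u × v ~[ π ] y) ⊎ (x ~[ π ] v × u ~[ π ] y)

MergedOrbits-swap : {π : Perm n} {u v x y : Fin n} → MergedOrbits π u v x y → MergedOrbits π v u x y
MergedOrbits-swap (inj₁ x~y)        = inj₁ x~y
MergedOrbits-swap (inj₂ (inj₁ p))   = inj₂ (inj₂ p)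
MergedOrbits-swap (inj₂ (inj₂ p))   = inj₂ (inj₁ p)

MergedOrbits-trans : (π : Perm n) {u v x y w : Fin n} → ¬ u ~[ π ] v →
                     MergedOrbits π u v x y → MergedOrbits π u v y w → MergedOrbits π u v x w
MergedOrbits-trans π u≁v (inj₁ x~y) (inj₁ y~w)               = inj₁ (~-trans π x~y y~w)
MergedOrbits-trans π u≁v (inj₁ x~y) (inj₂ (inj₁ (y~u , v~w))) = inj₂ (inj₁ (~-trans π x~y y~u , v~w))
MergedOrbits-trans π u≁v (inj₁ x~y) (inj₂ (inj₂ (y~v , u~w))) = inj₂ (inj₂ (~-trans π x~y y~v , u~w))
MergedOrbits-trans π u≁v (inj₂ (inj₁ (x~u , v~y))) (inj₁ y~w) = inj₂ (inj₁ (x~u , ~-trans π v~y y~w))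
MergedOrbits-trans π u≁v (inj₂ (inj₂ (x~v , u~y))) (inj₁ y~w) = inj₂ (inj₂ (x~v , ~-trans π u~y y~w))
MergedOrbits-trans π u≁v (inj₂ (inj₁ (x~u , _))) (inj₂ (inj₂ (_ , u~w))) = inj₁ (~-trans π x~u u~w)
MergedOrbits-trans π u≁v (inj₂ (inj₂ (x~v , _))) (inj₂ (inj₁ (_ , v~w))) = inj₁ (~-trans π x~v v~w)
MergedOrbits-trans π u≁v (inj₂ (inj₁ (_ , v~y))) (inj₂ (inj₁ (y~u , _))) = ⊥-elim (u≁v (~-sym π (~-trans π v~y y~u)))
MergedOrbits-trans π u≁v (inj₂ (inj₂ (_ , u~y))) (inj₂ (inj₂ (y~v , _))) = ⊥-elim (u≁v (~-trans π u~y y~v))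

-- Of the two fused orbits only the one with the smaller minimum keeps its minimum.
z-fuse-< : (π π' : Perm n) {u v mu mv : Fin n} → OrbitMinOf π u mu → OrbitMinOf π v mv → mu Fin.< mv →
           u ~[ π' ] v → (∀ {x y} → x ~[ π ] y → x ~[ π' ] y) →
           (∀ {x y} → x ~[ π' ] y → MergedOrbits π u v x y) → z π ≡ suc (z π')
z-fuse-< π π' {u} {v} {mu} {mv} (u~mu , mu-min) (v~mv , mv-min) mu<mv u~v coarser merged = begin
  z π                           ≡⟨ z≡count-orbitMin π ⟩
  count (isOrbitMin? π)         ≡⟨ count-one-more (isOrbitMin? π) (isOrbitMin? π') mv mv-min mv-not-min′ stays-min
                                     (λ min′ y x~y → min′ y (coarser x~y)) ⟩
  suc (count (isOrbitMin? π'))  ≡⟨ cong suc (z≡count-orbitMin π') ⟨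
  suc (z π')                    ∎
  where
  open ≡-Reasoning
  mv-not-min′ : ¬ IsOrbitMin π' mv
  mv-not-min′ min′ = ℕₚ.<⇒≱ mu<mv
    (min′ mu (~-trans π' (coarser (~-sym π v~mv)) (~-trans π' (~-sym π' u~v) (coarser u~mu))))
  stays-min : ∀ x → x ≢ mv → IsOrbitMin π x → IsOrbitMin π' x
  stays-min x x≢mv min y x~y with merged x~y
  ... | inj₁ x~πy                = min y x~πy
  ... | inj₂ (inj₁ (x~u , v~y)) =
    ℕₚ.≤-trans (min mu (~-trans π x~u u~mu)) (ℕₚ.≤-trans (ℕₚ.<⇒≤ mu<mv) (mv-min y (~-trans π (~-sym π v~mv) v~y)))
  ... | inj₂ (inj₂ (x~v , _))   =
    ⊥-elim (x≢mv (Finₚ.≤-antisym (min mv (~-trans π x~v v~mv)) (mv-min x (~-sym π (~-trans π x~v v~mv)))))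

z-fuse : (π π' : Perm n) {u v : Fin n} → ¬ u ~[ π ] v → u ~[ π' ] v →
         (∀ {x y} → x ~[ π ] y → x ~[ π' ] y) → (∀ {x y} → x ~[ π' ] y → MergedOrbits π u v x y) →
         z π ≡ suc (z π')
z-fuse π π' {u} {v} u≁v u~v coarser merged with orbitMin π u | orbitMin π v
... | mu , mu-min | mv , mv-min with Finₚ.<-cmp mu mv
...   | tri< mu<mv _ _ = z-fuse-< π π' mu-min mv-min mu<mv u~v coarser merged
...   | tri≈ _ refl _  = ⊥-elim (u≁v (~-trans π (proj₁ mu-min) (~-sym π (proj₁ mv-min))))
...   | tri> _ _ mv<mu = z-fuse-< π π' mv-min mu-min mv<mu (~-sym π' u~v) coarser (MergedOrbits-swap ∘ merged)

module TransposedProduct (π π' : Perm n) {u v : Fin n}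
                         (π'≗ : ∀ x → π' ⟨$⟩ʳ x ≡ transpose u v ⟨$⟩ʳ (π ⟨$⟩ʳ x)) where

  module _ {x : Fin n} {t : ℕ}
           (avoid : ∀ j → j ℕ.< t → iter π (suc j) x ≢ u × iter π (suc j) x ≢ v) where

    iter-agree : ∀ k → k ℕ.≤ t → iter π' k x ≡ iter π k x
    iter-agree zero    _    = refl
    iter-agree (suc k) k<t = begin
      π' ⟨$⟩ʳ iter π' k x                       ≡⟨ π'≗ _ ⟩
      transpose u v ⟨$⟩ʳ (π ⟨$⟩ʳ iter π' k x)   ≡⟨ cong (λ y → transpose u v ⟨$⟩ʳ (π ⟨$⟩ʳ y)) (iter-agree k (ℕₚ.<⇒≤ k<t)) ⟩
      transpose u v ⟨$⟩ʳ iter π (suc k) x       ≡⟨ transpose-≢ u v (proj₁ (avoid k k<t)) (proj₂ (avoid k k<t)) ⟩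
      iter π (suc k) x                          ∎
      where open ≡-Reasoning

    iter-agree-suc : iter π' (suc t) x ≡ transpose u v ⟨$⟩ʳ iter π (suc t) x
    iter-agree-suc = trans (π'≗ _) (cong (λ y → transpose u v ⟨$⟩ʳ (π ⟨$⟩ʳ y)) (iter-agree t ℕₚ.≤-refl))

  module _ (u≁v : ¬ u ~[ π ] v) where

    joined : u ~[ π' ] v
    joined with firstHit π (~-refl π {u})
    ... | t , hit , below = suc t , (begin
      iter π' (suc t) u                    ≡⟨ iter-agree-suc avoid ⟩
      transpose u v ⟨$⟩ʳ iter π (suc t) u  ≡⟨ cong (transpose u v ⟨$⟩ʳ_) hit ⟩
      transpose u v ⟨$⟩ʳ u                 ≡⟨ transpose-≡ˡ u v ⟩
      v                                    ∎)
      where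
      open ≡-Reasoning
      avoid : ∀ j → j ℕ.< t → iter π (suc j) u ≢ u × iter π (suc j) u ≢ v
      avoid j j<t = below j j<t , λ eq → u≁v (suc j , eq)

    coarser : ∀ {x y} → x ~[ π ] y → x ~[ π' ] y
    coarser = ~-induction π (λ x y → x ~[ π' ] y) (~-refl π') (~-trans π') step
      where
      step : ∀ x → x ~[ π' ] π ⟨$⟩ʳ x
      step x with PC.transpose u v (π ⟨$⟩ʳ x) | transpose-case u v (π ⟨$⟩ʳ x) | π'≗ x
      ... | _ | at-u πx≡u       | π'x≡v  = subst (x ~[ π' ]_) (sym πx≡u) (~-trans π' (1 , π'x≡v) (~-sym π' joined))
      ... | _ | at-v πx≡v       | π'x≡u  = subst (x ~[ π' ]_) (sym πx≡v) (~-trans π' (1 , π'x≡u) joined)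
      ... | _ | elsewhere _ _   | π'x≡πx = 1 , π'x≡πx

    merged : ∀ {x y} → x ~[ π' ] y → MergedOrbits π u v x y
    merged = ~-induction π' (MergedOrbits π u v) (inj₁ (~-refl π)) (MergedOrbits-trans π u≁v) step
      where
      step : ∀ x → MergedOrbits π u v x (π' ⟨$⟩ʳ x)
      step x with PC.transpose u v (π ⟨$⟩ʳ x) | transpose-case u v (π ⟨$⟩ʳ x) | π'≗ x
      ... | _ | at-u πx≡u     | π'x≡v  =
        subst (MergedOrbits π u v x) (sym π'x≡v) (inj₂ (inj₁ (subst (x ~[ π ]_) πx≡u (~-step π x) , ~-refl π)))
      ... | _ | at-v πx≡v     | π'x≡u  =
        subst (MergedOrbits π u v x) (sym π'x≡u) (inj₂ (inj₂ (subst (x ~[ π ]_) πx≡v (~-step π x) , ~-refl π)))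
      ... | _ | elsewhere _ _ | π'x≡πx = inj₁ (1 , sym π'x≡πx)

    z-merge : z π ≡ suc (z π')
    z-merge = z-fuse π π' u≁v joined coarser merged

  -- The π-orbit of u, cut open at the first visit of v, closes up in π' before reaching v.
  separated : u ≢ v → u ~[ π ] v → ¬ u ~[ π' ] v
  separated u≢v u~v with firstHit π u~v
  ... | t , hit , below = λ (k , πᵏu≡v) →
    let j , j≤t , eq = iter-periodic π' cycle k in never-v j j≤t (trans (sym eq) πᵏu≡v)
    where
    avoid : ∀ j → j ℕ.< t → iter π (suc j) u ≢ u × iter π (suc j) u ≢ v
    avoid j j<t = firstHit-noReturn π (hit , below) j j<t , below j j<t
    cycle : iter π' (suc t) u ≡ u
    cycle = trans (iter-agree-suc avoid) (trans (cong (transpose u v ⟨$⟩ʳ_) hit) (transpose-≡ʳ u v))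
    never-v : ∀ j → j ℕ.≤ t → iter π' j u ≢ v
    never-v zero    _    = u≢v
    never-v (suc j) j<t = below j j<t ∘ trans (sym (iter-agree avoid (suc j) j<t))

z-split : (π π' : Perm n) {u v : Fin n} → (∀ x → π' ⟨$⟩ʳ x ≡ transpose u v ⟨$⟩ʳ (π ⟨$⟩ʳ x)) →
          u ≢ v → u ~[ π ] v → z π' ≡ suc (z π)
z-split π π' {u} {v} π'≗ u≢v u~v =
  TransposedProduct.z-merge π' π π≗ (TransposedProduct.separated π π' π'≗ u≢v u~v)
  where
  π≗ : ∀ x → π ⟨$⟩ʳ x ≡ transpose u v ⟨$⟩ʳ (π' ⟨$⟩ʳ x)
  π≗ x = sym (trans (cong (transpose u v ⟨$⟩ʳ_) (π'≗ x)) (transpose-involutive u v _))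

-- Lifts and insertions

iter-lift₀-zero : (π : Perm n) (k : ℕ) → iter (lift₀ π) k zero ≡ zero
iter-lift₀-zero π zero    = refl
iter-lift₀-zero π (suc k) = cong (lift₀ π ⟨$⟩ʳ_) (iter-lift₀-zero π k)

iter-lift₀-suc : (π : Perm n) (k : ℕ) (x : Fin n) → iter (lift₀ π) k (suc x) ≡ suc (iter π k x)
iter-lift₀-suc π zero    x = refl
iter-lift₀-suc π (suc k) x = cong (lift₀ π ⟨$⟩ʳ_) (iter-lift₀-suc π k x)

zero≁suc-lift₀ : (π : Perm n) {y : Fin n} → ¬ zero ~[ lift₀ π ] suc y
zero≁suc-lift₀ π (k , eq) with trans (sym (iter-lift₀-zero π k)) eq
... | ()

suc≁zero-lift₀ : (π : Perm n) {x : Fin n} → ¬ suc x ~[ lift₀ π ] zero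
suc≁zero-lift₀ π {x} (k , eq) with trans (sym (iter-lift₀-suc π k x)) eq
... | ()

lift₀-~⁺ : (π : Perm n) {x y : Fin n} → x ~[ π ] y → suc x ~[ lift₀ π ] suc y
lift₀-~⁺ π {x} (k , eq) = k , trans (iter-lift₀-suc π k x) (cong suc eq)

lift₀-~⁻ : (π : Perm n) {x y : Fin n} → suc x ~[ lift₀ π ] suc y → x ~[ π ] y
lift₀-~⁻ π {x} (k , eq) = k , Finₚ.suc-injective (trans (sym (iter-lift₀-suc π k x)) eq)

lift₀-· : (π₁ π₂ : Perm n) (x : Fin (suc n)) → lift₀ (π₁ · π₂) ⟨$⟩ʳ x ≡ lift₀ π₁ ⟨$⟩ʳ (lift₀ π₂ ⟨$⟩ʳ x)
lift₀-· π₁ π₂ zero    = refl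
lift₀-· π₁ π₂ (suc x) = refl

z-lift₀ : (π : Perm n) → z (lift₀ π) ≡ suc (z π)
z-lift₀ π = trans (z≡count-orbitMin (lift₀ π)) (trans count-lift (cong suc (sym (z≡count-orbitMin π))))
  where
  count-lift : count (isOrbitMin? (lift₀ π)) ≡ suc (count (isOrbitMin? π))
  count-lift = trans (count-accept (isOrbitMin? (lift₀ π)) (λ _ _ → z≤n)) (cong suc (count-≐ _ (isOrbitMin? π)
    ( (λ min y x~y → ℕ.s≤s⁻¹ (min (suc y) (lift₀-~⁺ π x~y)))
    , λ min → λ { zero x~0 → ⊥-elim (suc≁zero-lift₀ π x~0) ; (suc y) x~y → s≤s (min y (lift₀-~⁻ π x~y)) })))

-- zero is spliced into the cycle of π just before c: π⁻¹ c ↦ zero ↦ c.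
insertBefore : Fin n → Perm n → Perm (suc n)
insertBefore c π = transpose zero (suc c) · lift₀ π

module Insertion (c : Fin n) (π : Perm n) where

  private
    module T = TransposedProduct (lift₀ π) (insertBefore c π) {zero} {suc c} (λ _ → refl)
    zero≁c = zero≁suc-lift₀ π

  z-insertBefore : z (insertBefore c π) ≡ z π
  z-insertBefore = ℕₚ.suc-injective (trans (sym (T.z-merge zero≁c)) (z-lift₀ π))

  suc~suc⁺ : ∀ {x y} → x ~[ π ] y → suc x ~[ insertBefore c π ] suc y
  suc~suc⁺ = T.coarser zero≁c ∘ lift₀-~⁺ π

  suc~suc⁻ : ∀ {x y} → suc x ~[ insertBefore c π ] suc y → x ~[ π ] y
  suc~suc⁻ x~y with T.merged zero≁c x~y
  ... | inj₁ x~πy              = lift₀-~⁻ π x~πy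
  ... | inj₂ (inj₁ (x~0 , _))  = ⊥-elim (suc≁zero-lift₀ π x~0)
  ... | inj₂ (inj₂ (_ , 0~y))  = ⊥-elim (zero≁suc-lift₀ π 0~y)

  zero~suc⁺ : ∀ {y} → c ~[ π ] y → zero ~[ insertBefore c π ] suc y
  zero~suc⁺ c~y = ~-trans (insertBefore c π) (T.joined zero≁c) (suc~suc⁺ c~y)

  zero~suc⁻ : ∀ {y} → zero ~[ insertBefore c π ] suc y → c ~[ π ] y
  zero~suc⁻ 0~y with T.merged zero≁c 0~y
  ... | inj₁ 0~πy              = ⊥-elim (zero≁suc-lift₀ π 0~πy)
  ... | inj₂ (inj₁ (_ , c~y))  = lift₀-~⁻ π c~y
  ... | inj₂ (inj₂ (0~c , _))  = ⊥-elim (zero≁suc-lift₀ π 0~c)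

-- Splice and cut

module SpliceAndCut (π : Perm n) (x s : Fin n) where

  ρ₁ ρ₂ : Perm (suc n)
  ρ₁ = insertBefore (π ⟨$⟩ʳ x) π
  ρ₂ = transpose zero (suc s) · ρ₁

  private
    module I = Insertion (π ⟨$⟩ʳ x) π
    module T = TransposedProduct ρ₁ ρ₂ {zero} {suc s} (λ _ → refl)

  z-ρ₁ : z ρ₁ ≡ z π
  z-ρ₁ = I.z-insertBefore

  ρ₁-zero~suc⁺ : ∀ {y} → x ~[ π ] y → zero ~[ ρ₁ ] suc y
  ρ₁-zero~suc⁺ x~y = I.zero~suc⁺ (~-trans π (~-sym π (~-step π x)) x~y)

  ρ₁-zero~suc⁻ : ∀ {y} → zero ~[ ρ₁ ] suc y → x ~[ π ] y
  ρ₁-zero~suc⁻ 0~y = ~-trans π (~-step π x) (I.zero~suc⁻ 0~y)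

  module Apart (x≁s : ¬ x ~[ π ] s) where

    private
      zero≁s : ¬ zero ~[ ρ₁ ] suc s
      zero≁s = x≁s ∘ ρ₁-zero~suc⁻

    z-ρ₂ : z ρ₁ ≡ suc (z ρ₂)
    z-ρ₂ = T.z-merge zero≁s

    zero~suc⁺-x : ∀ {y} → x ~[ π ] y → zero ~[ ρ₂ ] suc y
    zero~suc⁺-x = T.coarser zero≁s ∘ ρ₁-zero~suc⁺

    zero~suc⁺-s : ∀ {y} → s ~[ π ] y → zero ~[ ρ₂ ] suc y
    zero~suc⁺-s s~y = ~-trans ρ₂ (T.joined zero≁s) (T.coarser zero≁s (I.suc~suc⁺ s~y))

    zero~suc⁻ : ∀ {y} → zero ~[ ρ₂ ] suc y → x ~[ π ] y ⊎ s ~[ π ] y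
    zero~suc⁻ 0~y with T.merged zero≁s 0~y
    ... | inj₁ 0~₁y              = inj₁ (ρ₁-zero~suc⁻ 0~₁y)
    ... | inj₂ (inj₁ (_ , s~₁y)) = inj₂ (I.suc~suc⁻ s~₁y)
    ... | inj₂ (inj₂ (0~₁s , _)) = ⊥-elim (zero≁s 0~₁s)

  module Together (x~s : x ~[ π ] s) where

    z-ρ₂ : z ρ₂ ≡ suc (z ρ₁)
    z-ρ₂ = z-split ρ₁ ρ₂ (λ _ → refl) (λ ()) (ρ₁-zero~suc⁺ x~s)

  -- With s first reached after t + 1 steps, the ρ₂-cycle of zero is zero ↦ π x ↦ ⋯ ↦ πᵗ x ↦ zero.
  module Cycle {t : ℕ} (hit : FirstHit π x s t) where

    cycleOfZero : ℕ → Fin (suc n)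
    cycleOfZero zero    = zero
    cycleOfZero (suc k) = suc (iter π (suc k) x)

    ρ₁-cycleOfZero : ∀ k → k ℕ.≤ t → ρ₁ ⟨$⟩ʳ cycleOfZero k ≡ suc (iter π (suc k) x)
    ρ₁-cycleOfZero zero    _   = transpose-≡ˡ zero (suc (π ⟨$⟩ʳ x))
    ρ₁-cycleOfZero (suc j) j<t = transpose-≢ zero (suc (π ⟨$⟩ʳ x)) (λ ())
      (firstHit-noReturn π hit j j<t ∘ ⟨$⟩ʳ-injective π ∘ Finₚ.suc-injective)

    iter-ρ₂-zero : ∀ k → k ℕ.≤ t → iter ρ₂ k zero ≡ cycleOfZero k
    iter-ρ₂-zero zero    _   = refl
    iter-ρ₂-zero (suc k) k<t = begin
      ρ₂ ⟨$⟩ʳ iter ρ₂ k zero                               ≡⟨ cong (ρ₂ ⟨$⟩ʳ_) (iter-ρ₂-zero k (ℕₚ.<⇒≤ k<t)) ⟩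
      transpose zero (suc s) ⟨$⟩ʳ (ρ₁ ⟨$⟩ʳ cycleOfZero k)  ≡⟨ cong (transpose zero (suc s) ⟨$⟩ʳ_) (ρ₁-cycleOfZero k (ℕₚ.<⇒≤ k<t)) ⟩
      transpose zero (suc s) ⟨$⟩ʳ suc (iter π (suc k) x)   ≡⟨ transpose-≢ zero (suc s) (λ ()) (proj₂ hit k k<t ∘ Finₚ.suc-injective) ⟩
      suc (iter π (suc k) x)                               ∎
      where open ≡-Reasoning

    ρ₂-cycle : iter ρ₂ (suc t) zero ≡ zero
    ρ₂-cycle = begin
      ρ₂ ⟨$⟩ʳ iter ρ₂ t zero                               ≡⟨ cong (ρ₂ ⟨$⟩ʳ_) (iter-ρ₂-zero t ℕₚ.≤-refl) ⟩
      transpose zero (suc s) ⟨$⟩ʳ (ρ₁ ⟨$⟩ʳ cycleOfZero t)  ≡⟨ cong (transpose zero (suc s) ⟨$⟩ʳ_) (ρ₁-cycleOfZero t ℕₚ.≤-refl) ⟩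
      transpose zero (suc s) ⟨$⟩ʳ suc (iter π (suc t) x)   ≡⟨ cong (λ y → transpose zero (suc s) ⟨$⟩ʳ suc y) (proj₁ hit) ⟩
      transpose zero (suc s) ⟨$⟩ʳ suc s                    ≡⟨ transpose-≡ʳ zero (suc s) ⟩
      zero                                                 ∎
      where open ≡-Reasoning

    zero~suc⇔within : ∀ {y} → zero ~[ ρ₂ ] suc y ⇔ Within π x t y
    zero~suc⇔within {y} = mk⇔ to (λ (j , j<t , eq) → suc j , trans (iter-ρ₂-zero (suc j) j<t) (cong suc eq))
      where
      onCycle : ∀ j → j ℕ.≤ t → cycleOfZero j ≡ suc y → Within π x t y
      onCycle zero    _   ()
      onCycle (suc j) j<t eq = j , j<t , Finₚ.suc-injective eq
      to : zero ~[ ρ₂ ] suc y → Within π x t y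
      to (k , eq) with iter-periodic ρ₂ ρ₂-cycle k
      ... | j , j≤t , eqj = onCycle j j≤t (trans (sym (trans eqj (iter-ρ₂-zero j j≤t))) eq)

/-distribʳ-+ : ∀ i j d → (i ℤ.+ j) ℚ./ suc d ≡ i ℚ./ suc d ℚ.+ j ℚ./ suc d
/-distribʳ-+ i j d = ℚₚ.toℚᵘ-injective (begin
  toℚᵘ ((i ℤ.+ j) ℚ./ suc d)                   ≈⟨ ℚₚ.toℚᵘ-fromℚᵘ (ℚᵘ.mkℚᵘ (i ℤ.+ j) d) ⟩
  ℚᵘ.mkℚᵘ (i ℤ.+ j) d                          ≈⟨ ℚᵘ.*≡* (solve 3 (λ i j D → (i :+ j) :* (D :* D) := (i :* D :+ j :* D) :* D) refl i j (+ suc d)) ⟩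
  ℚᵘ.mkℚᵘ i d ℚᵘ.+ ℚᵘ.mkℚᵘ j d                 ≈⟨ ℚᵘₚ.+-cong (ℚₚ.toℚᵘ-fromℚᵘ (ℚᵘ.mkℚᵘ i d)) (ℚₚ.toℚᵘ-fromℚᵘ (ℚᵘ.mkℚᵘ j d)) ⟨
  toℚᵘ (i ℚ./ suc d) ℚᵘ.+ toℚᵘ (j ℚ./ suc d)   ≈⟨ ℚₚ.toℚᵘ-homo-+ (i ℚ./ suc d) (j ℚ./ suc d) ⟨
  toℚᵘ (i ℚ./ suc d ℚ.+ j ℚ./ suc d)           ∎)
  where
  open ℚᵘₚ.≃-Reasoning
  open +-*-Solver

genus-shift : ∀ χ δ → 1ℚ ℚ.- (χ ℤ.+ δ) ℚ./ 2 ≡ (1ℚ ℚ.- χ ℚ./ 2) ℚ.- δ ℚ./ 2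
genus-shift χ δ = trans (cong (λ q → 1ℚ ℚ.- q) (/-distribʳ-+ χ δ 1))
  (solve 2 (λ p q → con 1ℚ :- (p :+ q) := (con 1ℚ :- p) :- q) refl (χ ℚ./ 2) (δ ℚ./ 2))
  where open ℚSolver.+-*-Solver

-- The reroute

module Reroute (a b : Fin n) (a≢b : a ≢ b) (s∘ s• : Perm n) where

  ρ σ∘⊕ σ•⊕ ρ⊕ : Perm _
  ρ   = s∘ · s•
  σ∘⊕ = reroute∘ a b s∘ s•
  σ•⊕ = reroute• a b s∘ s•
  ρ⊕  = σ∘⊕ · σ•⊕

  open SpliceAndCut ρ a (s∘ ⟨$⟩ʳ a)

  z-σ∘⊕ : z σ∘⊕ ≡ z s∘
  z-σ∘⊕ = Insertion.z-insertBefore b s∘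

  z-σ•⊕ : z σ•⊕ ≡ suc (z s•)
  z-σ•⊕ = trans (z-split ν σ•⊕ σ•⊕≗ (λ ()) zero~a) (cong suc (Insertion.z-insertBefore (s• ⟨$⟩ʳ a) s•))
    where
    ν = insertBefore (s• ⟨$⟩ʳ a) s•
    σ•⊕≗ : ∀ x → σ•⊕ ⟨$⟩ʳ x ≡ transpose zero (suc a) ⟨$⟩ʳ (ν ⟨$⟩ʳ x)
    σ•⊕≗ x = cong (transpose zero (suc a) ⟨$⟩ʳ_) (transpose-conjugate (lift₀ s•) zero (suc a) x)
    zero~a : zero ~[ ν ] suc a
    zero~a = Insertion.zero~suc⁺ (s• ⟨$⟩ʳ a) s• (~-sym s• (~-step s• a))

  ρ⊕≗ : ∀ x → ρ⊕ ⟨$⟩ʳ x ≡ transpose zero (suc b) ⟨$⟩ʳ (ρ₂ ⟨$⟩ʳ x)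
  ρ⊕≗ x = cong (transpose zero (suc b) ⟨$⟩ʳ_) (begin
    L∘ ⟨$⟩ʳ (τ ⟨$⟩ʳ (L• ⟨$⟩ʳ (τ ⟨$⟩ʳ x)))         ≡⟨ transpose-conjugate L∘ zero (suc a) (L• ⟨$⟩ʳ (τ ⟨$⟩ʳ x)) ⟩
    τ∘ ⟨$⟩ʳ (L∘ ⟨$⟩ʳ (L• ⟨$⟩ʳ (τ ⟨$⟩ʳ x)))        ≡⟨ cong (λ y → τ∘ ⟨$⟩ʳ (L∘ ⟨$⟩ʳ y)) (transpose-conjugate L• zero (suc a) x) ⟩
    τ∘ ⟨$⟩ʳ (L∘ ⟨$⟩ʳ (τ• ⟨$⟩ʳ (L• ⟨$⟩ʳ x)))       ≡⟨ cong (τ∘ ⟨$⟩ʳ_) (transpose-conjugate L∘ zero (suc (s• ⟨$⟩ʳ a)) (L• ⟨$⟩ʳ x)) ⟩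
    τ∘ ⟨$⟩ʳ (τρ ⟨$⟩ʳ (L∘ ⟨$⟩ʳ (L• ⟨$⟩ʳ x)))       ≡⟨ cong (λ y → τ∘ ⟨$⟩ʳ (τρ ⟨$⟩ʳ y)) (lift₀-· s∘ s• x) ⟨
    τ∘ ⟨$⟩ʳ (τρ ⟨$⟩ʳ (lift₀ ρ ⟨$⟩ʳ x))             ∎)
    where
    open ≡-Reasoning
    L∘ = lift₀ s∘
    L• = lift₀ s•
    τ  = transpose zero (suc a)
    τ∘ = transpose zero (suc (s∘ ⟨$⟩ʳ a))
    τ• = transpose zero (suc (s• ⟨$⟩ʳ a))
    τρ = transpose zero (suc (ρ ⟨$⟩ʳ a))

  z-apart-split : ¬ a ~[ ρ ] s∘ ⟨$⟩ʳ a → zero ~[ ρ₂ ] suc b → z ρ⊕ ≡ z ρ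
  z-apart-split a≁sa zero~b = begin
    z ρ⊕        ≡⟨ z-split ρ₂ ρ⊕ ρ⊕≗ (λ ()) zero~b ⟩
    suc (z ρ₂)  ≡⟨ Apart.z-ρ₂ a≁sa ⟨
    z ρ₁        ≡⟨ z-ρ₁ ⟩
    z ρ         ∎
    where open ≡-Reasoning

  z-together-merge : a ~[ ρ ] s∘ ⟨$⟩ʳ a → ¬ zero ~[ ρ₂ ] suc b → z ρ⊕ ≡ z ρ
  z-together-merge a~sa zero≁b = ℕₚ.suc-injective (begin
    suc (z ρ⊕)  ≡⟨ TransposedProduct.z-merge ρ₂ ρ⊕ ρ⊕≗ zero≁b ⟨
    z ρ₂        ≡⟨ Together.z-ρ₂ a~sa ⟩
    suc (z ρ₁)  ≡⟨ cong suc z-ρ₁ ⟩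
    suc (z ρ)   ∎)
    where open ≡-Reasoning

  zero~b⇔typeN : a ~[ ρ ] s∘ ⟨$⟩ʳ a → zero ~[ ρ₂ ] suc b ⇔ TypeN s∘ s• a b
  zero~b⇔typeN a~sa with firstHit ρ a~sa
  ... | t , hit = mk⇔
    (λ zero~b → let j , j<t , eq = to zero~b in (a~sa , (suc j , eq)) , within⇒¬arc ρ hit (j , j<t , eq))
    (λ ((_ , a~b) , ¬arc) → from (¬arc⇒within ρ hit a≢b a~b ¬arc))
    where open Equivalence (Cycle.zero~suc⇔within hit)

  z-typeU : TypeU s∘ s• a b → z ρ ≡ suc (suc (z ρ⊕))
  z-typeU (_ , a≁sa , a≁b , sa≁b) = begin
    z ρ               ≡⟨ z-ρ₁ ⟨
    z ρ₁              ≡⟨ Apart.z-ρ₂ a≁sa ⟩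
    suc (z ρ₂)        ≡⟨ cong suc (TransposedProduct.z-merge ρ₂ ρ⊕ ρ⊕≗ ([ a≁b , sa≁b ] ∘ Apart.zero~suc⁻ a≁sa)) ⟩
    suc (suc (z ρ⊕))  ∎
    where open ≡-Reasoning

  z-typeN : TypeN s∘ s• a b → z ρ⊕ ≡ suc (suc (z ρ))
  z-typeN N@((a~sa , _) , _) = begin
    z ρ⊕              ≡⟨ z-split ρ₂ ρ⊕ ρ⊕≗ (λ ()) (Equivalence.from (zero~b⇔typeN a~sa) N) ⟩
    suc (z ρ₂)        ≡⟨ cong suc (Together.z-ρ₂ a~sa) ⟩
    suc (suc (z ρ₁))  ≡⟨ cong (λ k → suc (suc k)) z-ρ₁ ⟩
    suc (suc (z ρ))   ∎
    where open ≡-Reasoning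

  z-typeP : TypeP s∘ s• a b → z ρ⊕ ≡ z ρ
  z-typeP (¬U , ¬N) with ~-dec ρ a (s∘ ⟨$⟩ʳ a)
  ... | yes a~sa with ~-dec ρ₂ zero (suc b)
  ...   | yes zero~b = ⊥-elim (¬N (Equivalence.to (zero~b⇔typeN a~sa) zero~b))
  ...   | no  zero≁b = z-together-merge a~sa zero≁b
  z-typeP (¬U , ¬N) | no a≁sa with ~-dec ρ a b | ~-dec ρ (s∘ ⟨$⟩ʳ a) b
  ...   | yes a~b | _        = z-apart-split a≁sa (Apart.zero~suc⁺-x a≁sa a~b)
  ...   | no _    | yes sa~b = z-apart-split a≁sa (Apart.zero~suc⁺-s a≁sa sa~b)
  ...   | no a≁b  | no sa≁b  = ⊥-elim (¬U (distinct , a≁sa , a≁b , sa≁b))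
    where
    distinct : a ≢ s∘ ⟨$⟩ʳ a × a ≢ b × s∘ ⟨$⟩ʳ a ≢ b
    distinct = (λ eq → a≁sa (0 , eq)) , a≢b , λ eq → sa≁b (0 , eq)

  χ-reroute : ∀ δ → + z ρ⊕ ≡ + z ρ ℤ.+ δ → χ σ∘⊕ σ•⊕ ≡ χ s∘ s• ℤ.+ δ
  χ-reroute δ eq = begin
    ((+ z σ∘⊕ ℤ.+ + z σ•⊕) ℤ.- + suc n) ℤ.+ + z ρ⊕            ≡⟨ cong₂ (λ p q → ((+ p ℤ.+ + q) ℤ.- + suc n) ℤ.+ + z ρ⊕) z-σ∘⊕ z-σ•⊕ ⟩
    ((+ z s∘ ℤ.+ + suc (z s•)) ℤ.- + suc n) ℤ.+ + z ρ⊕         ≡⟨ cong (λ c → ((+ z s∘ ℤ.+ + suc (z s•)) ℤ.- + suc n) ℤ.+ c) eq ⟩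
    ((+ z s∘ ℤ.+ + suc (z s•)) ℤ.- + suc n) ℤ.+ (+ z ρ ℤ.+ δ)  ≡⟨ solve 5 (λ A B C m d → ((A :+ (con (+ 1) :+ B)) :- (con (+ 1) :+ m)) :+ (C :+ d)
                                                                              := (((A :+ B) :- m) :+ C) :+ d) refl (+ z s∘) (+ z s•) (+ z ρ) (+ n) δ ⟩
    (((+ z s∘ ℤ.+ + z s•) ℤ.- + n) ℤ.+ + z ρ) ℤ.+ δ            ∎
    where
    open ≡-Reasoning
    open +-*-Solver

  genus-reroute : ∀ δ → + z ρ⊕ ≡ + z ρ ℤ.+ δ → genus σ∘⊕ σ•⊕ ≡ genus s∘ s• ℚ.- δ ℚ./ 2
  genus-reroute δ eq = trans (cong (λ c → 1ℚ ℚ.- c ℚ./ 2) (χ-reroute δ eq)) (genus-shift (χ s∘ s•) δ)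

  -- Below, + (2 + k) ℤ.+ -[1+ 1 ] reduces to + k, and -[1+ 1 ] / 2, + 2 / 2, + 0 / 2 to −1, 1, 0.
  genus-typeU : TypeU s∘ s• a b → genus σ∘⊕ σ•⊕ ≡ genus s∘ s• ℚ.+ 1ℚ
  genus-typeU U = genus-reroute -[1+ 1 ] (cong (λ k → + k ℤ.+ -[1+ 1 ]) (sym (z-typeU U)))

  genus-typeN : TypeN s∘ s• a b → genus σ∘⊕ σ•⊕ ≡ genus s∘ s• ℚ.- 1ℚ
  genus-typeN N = genus-reroute (+ 2) (cong +_ (trans (z-typeN N) (ℕₚ.+-comm 2 (z ρ))))

  genus-typeP : TypeP s∘ s• a b → genus σ∘⊕ σ•⊕ ≡ genus s∘ s•
  genus-typeP P = trans (genus-reroute (+ 0) (cong +_ (trans (z-typeP P) (sym (ℕₚ.+-identityʳ (z ρ))))))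
                        (ℚₚ.+-identityʳ (genus s∘ s•))

mainTheorem1 : (n : ℕ) (a b : Fin n) → a ≢ b → (s∘ s• : Perm n) →
    let g  = genus s∘ s•
        g⊕ = genus (reroute∘ a b s∘ s•) (reroute• a b s∘ s•)
    in (TypeU s∘ s• a b → g⊕ ≡ g ℚ.+ 1ℚ)
     × (TypeN s∘ s• a b → g⊕ ≡ g ℚ.- 1ℚ)
     × (TypeP s∘ s• a b → g⊕ ≡ g)
mainTheorem1 n a b a≢b s∘ s• = genus-typeU , genus-typeN , genus-typeP
  where open Reroute a b a≢b s∘ s•
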